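{- Let $m\ge4$. Let $A(x)=\frac{x}{1+x}$, $B^m(x)=\frac{x}{1+x^{m-2}}$, $B^m_0(x)=x$, $B^m_j(x)=B^m(B^m_{j-1}(x))$ for $j\ge1$, and $A^m_j(x)=A(B^m_j(x))$. The functional equation \[T^m(x)=1+\frac{x}{1+x}\,T^m\!\left(\frac{x}{1+x^{m-2}}\right)\] for a formal power series $T^m(x)$ (satisfied by the cluster generating function of the consecutive pattern $\tau_m=1\,m\,2\,3\cdots(m-1)$, described in the context) has the solution \[T^m(x)=1+\sum_{n=0}^{\infty}\prod_{j=0}^{n}A^m_j(x)=1+\sum_{n=0}^{\infty}\prod_{j=0}^{n}\frac{B^m_j(x)}{1+B^m_j(x)}.\]
   Context: For a consecutive pattern $\sigma$ of length $m$, a $k$-cluster of length $n\ge m$ is a permutation of $\{1,\dots,n\}$ that contains exactly $k$ occurrences of $\sigma$ as a consecutive pattern, in which every entry belongs to at least one occurrence, and in which any two successive occurrences overlap in at least one entry. Let $s_{n,k}$ be the number of these, with $s_{1,0}=1$ and $s_{n,k}=0$ otherwise for $n<m$; the cluster generating function is $T(x)=1+\sum_{n\ge1}\big(\sum_k(-1)^ks_{n,k}\big)x^n$. The pattern $\tau_m$ is $1\,m\,2\,3\ldots(m-2)(m-1)$, e.g. $\tau_4=1423$, $\tau_5=15234$. -}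

module Defs where

open import Data.Nat using (ℕ; zero; suc; _∸_; _≤_)
open import Data.Integer using (ℤ; 0ℤ; 1ℤ; -_) renaming (_+_ to _+ℤ_; _*_ to _*ℤ_)
open import Data.Product using (Σ; _×_; ∃)
open import Relation.Binary.PropositionalEquality using (_≡_)

-- Formal power series over ℤ, represented by their coefficient sequences:
-- f n is the coefficient of x^n.
FPS : Set
FPS = ℕ → ℤ

sumTo : ℕ → (ℕ → ℤ) → ℤ
sumTo zero    f = f 0
sumTo (suc n) f = sumTo n f +ℤ f (suc n)

zeroS : FPS
zeroS _ = 0ℤ

oneS : FPS
oneS zero    = 1ℤ
oneS (suc _) = 0ℤ

X : FPS
X (suc zero) = 1ℤ
X _          = 0ℤ

_⊕_ : FPS → FPS → FPS
(f ⊕ g) n = f n +ℤ g n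

_⊗_ : FPS → FPS → FPS
(f ⊗ g) n = sumTo n (λ i → f i *ℤ g (n ∸ i))

pow : FPS → ℕ → FPS
pow g zero    = oneS
pow g (suc k) = g ⊗ pow g k

-- composition f(g(x)), valid (and only used) when g has zero constant term:
-- [x^n] f(g) = Σ_{k=0}^{n} f_k [x^n] g^k
comp : FPS → FPS → FPS
comp f g n = sumTo n (λ k → f k *ℤ pow g k n)

-- the series 1/(1+y) = Σ (-1)^k y^k
geomAlt : FPS
geomAlt zero    = 1ℤ
geomAlt (suc k) = - geomAlt k

-- A(g) = g/(1+g)   (g with zero constant term)
Aop : FPS → FPS
Aop g = g ⊗ comp geomAlt g

-- B^m(g) = g/(1+g^{m-2})   (g with zero constant term, m ≥ 4)
Bop : ℕ → FPS → FPS
Bop m g = g ⊗ comp geomAlt (pow g (m ∸ 2))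

Aser : FPS
Aser = Aop X

Bser : ℕ → FPS
Bser m = Bop m X

Bj : ℕ → ℕ → FPS
Bj m zero    = X
Bj m (suc j) = Bop m (Bj m j)

Aj : ℕ → ℕ → FPS
Aj m j = Aop (Bj m j)

prodA : ℕ → ℕ → FPS
prodA m zero    = Aj m 0
prodA m (suc n) = prodA m n ⊗ Aj m (suc n)

partialSum : ℕ → ℕ → FPS
partialSum m zero    = oneS
partialSum m (suc M) = partialSum m M ⊕ prodA m M

SolvesFE : ℕ → FPS → Set
SolvesFE m T = ∀ n → T n ≡ (oneS ⊕ (Aser ⊗ comp T (Bser m))) n

-- A sequence of series converges (x-adically, i.e. coefficientwise eventually
-- constant) to T: the formal infinite sum equals T.
ConvergesTo : (ℕ → FPS) → FPS → Set
ConvergesTo s T = ∀ N → ∃ λ M → ∀ M′ → M ≤ M′ → s M′ N ≡ T N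

-- Write A(x) = x/(1+x), B(x) = x/(1+x^{m-2}), B_j for the j-th iterate of B and
-- P_M = ∏_{j≤M} A(B_j).  Two facts drive the proof.
--   (1) Composition with a series h of order ≥ 1 is a ring homomorphism that is
--       associative (f∘g)∘h = f∘(g∘h).  Hence B_j∘B = B_{j+1}, A(B_j)∘B = A(B_{j+1})
--       and A · (P_M∘B) = P_{M+1}, so the partial sums S_M = 1 + Σ_{n<M} P_n obey
--       S_{M+1} = 1 + A · (S_M∘B).
--   (2) P_M has order ≥ M+1, so the coefficient of x^N in S_M is constant for
--       M > N; the limit T∞ exists, and since A has order ≥ 1 the coefficient of
--       x^n in 1 + A · (T∘B) only involves coefficients of T below n.  This makes
--       T∞ a solution, and makes solutions of T = 1 + A·(T∘B) unique.
module Submission where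

open import Defs
open import Data.Nat as N using (ℕ; zero; suc; _∸_; _≤_; _<_; z≤n; s≤s)
import Data.Nat.Properties as NP
open import Data.Integer using (ℤ; 0ℤ; _+_; _*_)
import Data.Integer.Properties as ZP
open import Data.Sum using (inj₁; inj₂)
open import Data.Product using (Σ; _×_; _,_; proj₁; proj₂)
open import Data.Empty using (⊥-elim)
open import Relation.Nullary using (¬_; yes; no)
open import Relation.Binary.PropositionalEquality
open import Algebra.Properties.CommutativeSemigroup ZP.+-commutativeSemigroup
  using () renaming (interchange to +-interchange)
open import Algebra.Properties.CommutativeSemigroup ZP.*-commutativeSemigroup
  using () renaming (interchange to *-interchange)

n<i+b⇒n∸i<b : ∀ i b n → n < i N.+ b → i ≤ n → n ∸ i < b
n<i+b⇒n∸i<b i b n lt le = NP.+-cancelˡ-< i (n ∸ i) b (subst (N._< i N.+ b) (sym (NP.m+[n∸m]≡n le)) lt)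

n∸i<j⇒n<i+j : ∀ n i j → n ∸ i < j → n < i N.+ j
n∸i<j⇒n<i+j n i j lt with NP.≤-total i n
... | inj₁ i≤n = subst (N._< i N.+ j) (NP.m+[n∸m]≡n i≤n) (NP.+-monoʳ-< i lt)
... | inj₂ n≤i = NP.≤-<-trans n≤i (NP.m<m+n i (NP.≤-<-trans z≤n lt))

*-zeroʳ-≡ : ∀ a {b} → b ≡ 0ℤ → a * b ≡ 0ℤ
*-zeroʳ-≡ a refl = ZP.*-zeroʳ a

*-zeroˡ-≡ : ∀ {a} b → a ≡ 0ℤ → a * b ≡ 0ℤ
*-zeroˡ-≡ b refl = ZP.*-zeroˡ b

sumTo-cong : ∀ n {f g : ℕ → ℤ} → (∀ i → i ≤ n → f i ≡ g i) → sumTo n f ≡ sumTo n g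
sumTo-cong zero    eq = eq 0 z≤n
sumTo-cong (suc n) eq = cong₂ _+_ (sumTo-cong n (λ i p → eq i (NP.m≤n⇒m≤1+n p))) (eq (suc n) NP.≤-refl)

sumTo-+ : ∀ n (f g : ℕ → ℤ) → sumTo n (λ i → f i + g i) ≡ sumTo n f + sumTo n g
sumTo-+ zero    f g = refl
sumTo-+ (suc n) f g =
  trans (cong (_+ (f (suc n) + g (suc n))) (sumTo-+ n f g)) (+-interchange (sumTo n f) (sumTo n g) _ _)

sumTo-*ˡ : ∀ n c (f : ℕ → ℤ) → c * sumTo n f ≡ sumTo n (λ i → c * f i)
sumTo-*ˡ zero    c f = refl
sumTo-*ˡ (suc n) c f =
  trans (ZP.*-distribˡ-+ c (sumTo n f) (f (suc n))) (cong (_+ (c * f (suc n))) (sumTo-*ˡ n c f))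

sumTo-*ʳ : ∀ n c (f : ℕ → ℤ) → sumTo n f * c ≡ sumTo n (λ i → f i * c)
sumTo-*ʳ zero    c f = refl
sumTo-*ʳ (suc n) c f =
  trans (ZP.*-distribʳ-+ c (sumTo n f) (f (suc n))) (cong (_+ (f (suc n) * c)) (sumTo-*ʳ n c f))

sumTo-zero : ∀ n (f : ℕ → ℤ) → (∀ i → i ≤ n → f i ≡ 0ℤ) → sumTo n f ≡ 0ℤ
sumTo-zero zero    f z = z 0 z≤n
sumTo-zero (suc n) f z = cong₂ _+_ (sumTo-zero n f (λ i p → z i (NP.m≤n⇒m≤1+n p))) (z (suc n) NP.≤-refl)

sumTo-extend : ∀ n N (f : ℕ → ℤ) → n ≤ N → (∀ i → n < i → i ≤ N → f i ≡ 0ℤ) → sumTo N f ≡ sumTo n f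
sumTo-extend n zero    f z≤n z = refl
sumTo-extend n (suc N) f le z with NP.m≤n⇒m<n∨m≡n le
... | inj₂ refl = refl
... | inj₁ lt   =
  trans (cong₂ _+_ (sumTo-extend n N f (NP.m<1+n⇒m≤n lt) (λ i p q → z i p (NP.m≤n⇒m≤1+n q)))
                   (z (suc N) lt NP.≤-refl))
        (ZP.+-identityʳ _)

sumTo-single : ∀ n k (f : ℕ → ℤ) → k ≤ n → (∀ i → i ≤ n → ¬ i ≡ k → f i ≡ 0ℤ) → sumTo n f ≡ f k
sumTo-single zero    .zero f z≤n z = refl
sumTo-single (suc n) k     f le  z with NP.m≤n⇒m<n∨m≡n le
... | inj₂ refl =
  trans (cong (_+ f (suc n)) (sumTo-zero n f (λ i p → z i (NP.m≤n⇒m≤1+n p) (λ e → NP.<-irrefl e (s≤s p)))))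
        (ZP.+-identityˡ _)
... | inj₁ lt   =
  trans (cong₂ _+_ (sumTo-single n k f (NP.m<1+n⇒m≤n lt) (λ i p → z i (NP.m≤n⇒m≤1+n p)))
                   (z (suc n) NP.≤-refl (λ e → NP.<-irrefl (sym e) lt)))
        (ZP.+-identityʳ _)

sumTo-swap : ∀ n m (F : ℕ → ℕ → ℤ) → sumTo n (λ i → sumTo m (F i)) ≡ sumTo m (λ j → sumTo n (λ i → F i j))
sumTo-swap zero    m F = refl
sumTo-swap (suc n) m F =
  trans (cong (_+ sumTo m (F (suc n))) (sumTo-swap n m F)) (sym (sumTo-+ m (λ j → sumTo n (λ i → F i j)) (F (suc n))))

sumTo-triangle : ∀ n (G : ℕ → ℕ → ℤ) →
  sumTo n (λ i → sumTo i (G i)) ≡ sumTo n (λ j → sumTo (n ∸ j) (λ k → G (j N.+ k) j))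
sumTo-triangle zero    G = refl
sumTo-triangle (suc n) G = begin
    sumTo n (λ i → sumTo i (G i)) + sumTo (suc n) (G (suc n))
      ≡⟨ cong (_+ sumTo (suc n) (G (suc n))) (sumTo-triangle n G) ⟩
    Rows n + (sumTo n (G (suc n)) + G (suc n) (suc n))
      ≡⟨ sym (ZP.+-assoc (Rows n) _ _) ⟩
    (Rows n + sumTo n (G (suc n))) + G (suc n) (suc n)
      ≡⟨ cong₂ _+_ (sym (sumTo-+ n (λ j → sumTo (n ∸ j) (H j)) (G (suc n)))) diagonal ⟩
    sumTo n (λ j → sumTo (n ∸ j) (H j) + G (suc n) j) + sumTo (suc n ∸ suc n) (H (suc n))
      ≡⟨ cong (_+ sumTo (suc n ∸ suc n) (H (suc n))) (sumTo-cong n lengthenRow) ⟩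
    sumTo n (λ j → sumTo (suc n ∸ j) (H j)) + sumTo (suc n ∸ suc n) (H (suc n)) ∎
  where
  open ≡-Reasoning
  H : ℕ → ℕ → ℤ
  H j k = G (j N.+ k) j
  Rows : ℕ → ℤ
  Rows n = sumTo n (λ j → sumTo (n ∸ j) (H j))
  diagonal : G (suc n) (suc n) ≡ sumTo (n ∸ n) (H (suc n))
  diagonal rewrite NP.n∸n≡0 n | NP.+-identityʳ n = refl
  lengthenRow : ∀ j → j ≤ n → sumTo (n ∸ j) (H j) + G (suc n) j ≡ sumTo (suc n ∸ j) (H j)
  lengthenRow j le rewrite NP.+-∸-assoc 1 le =
    cong (sumTo (n ∸ j) (H j) +_) (cong (λ x → G x j) (sym (trans (NP.+-suc j (n ∸ j)) (cong suc (NP.m+[n∸m]≡n le)))))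

infix 4 _≈_
_≈_ : FPS → FPS → Set
f ≈ g = ∀ n → f n ≡ g n

≈-refl : ∀ {f} → f ≈ f
≈-refl _ = refl

≈-sym : ∀ {f g} → f ≈ g → g ≈ f
≈-sym p n = sym (p n)

≈-trans : ∀ {f g h} → f ≈ g → g ≈ h → f ≈ h
≈-trans p q n = trans (p n) (q n)

VanishesBelow : ℕ → FPS → Set
VanishesBelow k f = ∀ i → i < k → f i ≡ 0ℤ

⊗-cong : ∀ {f f′ g g′} → f ≈ f′ → g ≈ g′ → f ⊗ g ≈ f′ ⊗ g′
⊗-cong p q n = sumTo-cong n (λ i _ → cong₂ _*_ (p i) (q (n ∸ i)))

⊗-congˡ : ∀ f {g g′} → g ≈ g′ → f ⊗ g ≈ f ⊗ g′
⊗-congˡ f = ⊗-cong {f} {f} ≈-refl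

pow-cong : ∀ {g g′} k → g ≈ g′ → pow g k ≈ pow g′ k
pow-cong zero    p n = refl
pow-cong (suc k) p   = ⊗-cong p (pow-cong k p)

⊗-assoc : ∀ f g h → (f ⊗ g) ⊗ h ≈ f ⊗ (g ⊗ h)
⊗-assoc f g h n = begin
  sumTo n (λ i → sumTo i (λ j → f j * g (i ∸ j)) * h (n ∸ i))
    ≡⟨ sumTo-cong n (λ i _ → sumTo-*ʳ i (h (n ∸ i)) _) ⟩
  sumTo n (λ i → sumTo i (λ j → f j * g (i ∸ j) * h (n ∸ i)))
    ≡⟨ sumTo-triangle n _ ⟩
  sumTo n (λ j → sumTo (n ∸ j) (λ k → f j * g (j N.+ k ∸ j) * h (n ∸ (j N.+ k))))
    ≡⟨ sumTo-cong n (λ j _ → trans (sumTo-cong (n ∸ j) (λ k _ → reindex j k)) (sym (sumTo-*ˡ (n ∸ j) (f j) _))) ⟩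
  sumTo n (λ j → f j * sumTo (n ∸ j) (λ k → g k * h (n ∸ j ∸ k))) ∎
  where
  open ≡-Reasoning
  reindex : ∀ j k → f j * g (j N.+ k ∸ j) * h (n ∸ (j N.+ k)) ≡ f j * (g k * h (n ∸ j ∸ k))
  reindex j k rewrite NP.m+n∸m≡n j k | NP.∸-+-assoc n j k = ZP.*-assoc (f j) (g k) _

⊗-identityˡ : ∀ g → oneS ⊗ g ≈ g
⊗-identityˡ g n = trans (sumTo-single n 0 _ z≤n offConstant) (ZP.*-identityˡ (g n))
  where
  offConstant : ∀ i → i ≤ n → ¬ i ≡ 0 → oneS i * g (n ∸ i) ≡ 0ℤ
  offConstant zero    _ ne = ⊥-elim (ne refl)
  offConstant (suc i) _ _  = refl

⊗-identityʳ : ∀ g → g ⊗ oneS ≈ g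
⊗-identityʳ g n =
  trans (sumTo-single n n _ NP.≤-refl offDiagonal) (trans (cong (λ x → g n * oneS x) (NP.n∸n≡0 n)) (ZP.*-identityʳ (g n)))
  where
  offDiagonal : ∀ i → i ≤ n → ¬ i ≡ n → g i * oneS (n ∸ i) ≡ 0ℤ
  offDiagonal i le ne with n ∸ i | NP.m+[n∸m]≡n le
  ... | zero  | e = ⊥-elim (ne (trans (sym (NP.+-identityʳ i)) e))
  ... | suc _ | _ = ZP.*-zeroʳ (g i)

⊗-distribˡ-⊕ : ∀ f g h → f ⊗ (g ⊕ h) ≈ (f ⊗ g) ⊕ (f ⊗ h)
⊗-distribˡ-⊕ f g h n = trans (sumTo-cong n (λ i _ → ZP.*-distribˡ-+ (f i) (g (n ∸ i)) (h (n ∸ i)))) (sumTo-+ n _ _)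

vanishes-⊗ : ∀ a b f g → VanishesBelow a f → VanishesBelow b g → VanishesBelow (a N.+ b) (f ⊗ g)
vanishes-⊗ a b f g vf vg n lt = sumTo-zero n _ term
  where
  term : ∀ i → i ≤ n → f i * g (n ∸ i) ≡ 0ℤ
  term i le with i N.<? a
  ... | yes i<a = *-zeroˡ-≡ (g (n ∸ i)) (vf i i<a)
  ... | no  i≮a = *-zeroʳ-≡ (f i) (vg (n ∸ i)
                    (n<i+b⇒n∸i<b i b n (NP.<-≤-trans lt (NP.+-monoˡ-≤ b (NP.≮⇒≥ i≮a))) le))

vanishes1-⊗ : ∀ f g → VanishesBelow 1 f → VanishesBelow 1 (f ⊗ g)
vanishes1-⊗ f g v zero    _         = *-zeroˡ-≡ (g 0) (v 0 (s≤s z≤n))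
vanishes1-⊗ f g v (suc i) (s≤s ())

vanishes1-X : VanishesBelow 1 X
vanishes1-X zero    _ = refl
vanishes1-X (suc i) (s≤s ())

vanishes-pow : ∀ g → VanishesBelow 1 g → ∀ k → VanishesBelow k (pow g k)
vanishes-pow g v zero    i ()
vanishes-pow g v (suc k) = vanishes-⊗ 1 k g (pow g k) v (vanishes-pow g v k)

vanishes1-pow : ∀ g k → 1 ≤ k → VanishesBelow 1 g → VanishesBelow 1 (pow g k)
vanishes1-pow g (suc k) _ v = vanishes1-⊗ g (pow g k) v

pow-+ : ∀ h i j → pow h (i N.+ j) ≈ pow h i ⊗ pow h j
pow-+ h zero    j = ≈-sym (⊗-identityˡ (pow h j))
pow-+ h (suc i) j = ≈-trans (⊗-congˡ h (pow-+ h i j)) (≈-sym (⊗-assoc h (pow h i) (pow h j)))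

comp-cong : ∀ {f f′ g g′} → f ≈ f′ → g ≈ g′ → comp f g ≈ comp f′ g′
comp-cong p q n = sumTo-cong n (λ k _ → cong₂ _*_ (p k) (pow-cong k q n))

comp-congˡ : ∀ f {g g′} → g ≈ g′ → comp f g ≈ comp f g′
comp-congˡ f = comp-cong {f} {f} ≈-refl

comp-distribʳ-⊕ : ∀ f g h → comp (f ⊕ g) h ≈ comp f h ⊕ comp g h
comp-distribʳ-⊕ f g h n = trans (sumTo-cong n (λ i _ → ZP.*-distribʳ-+ (pow h i n) (f i) (g i))) (sumTo-+ n _ _)

comp-oneS : ∀ h → comp oneS h ≈ oneS
comp-oneS h n = trans (sumTo-single n 0 _ z≤n offConstant) (ZP.*-identityˡ (oneS n))
  where
  offConstant : ∀ i → i ≤ n → ¬ i ≡ 0 → oneS i * pow h i n ≡ 0ℤ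
  offConstant zero    _ ne = ⊥-elim (ne refl)
  offConstant (suc i) _ _  = refl

comp-X : ∀ g → VanishesBelow 1 g → comp X g ≈ g
comp-X g v zero    = sym (v 0 (s≤s z≤n))
comp-X g v (suc n) =
  trans (sumTo-single (suc n) 1 _ (s≤s z≤n) offLinear) (trans (ZP.*-identityˡ _) (⊗-identityʳ g (suc n)))
  where
  offLinear : ∀ i → i ≤ suc n → ¬ i ≡ 1 → X i * pow g i (suc n) ≡ 0ℤ
  offLinear zero          _ _  = refl
  offLinear (suc zero)    _ ne = ⊥-elim (ne refl)
  offLinear (suc (suc i)) _ _  = refl

-- Both sides of (f·f′)∘h = (f∘h)·(f′∘h), at x^n, equal the double sum
-- Σ_{i,j≤n} f_i f′_j [x^n] h^{i+j}; terms with i + j > n vanish since h has order ≥ 1.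
ProductExpansion : FPS → FPS → FPS → ℕ → ℤ
ProductExpansion f f′ h n = sumTo n (λ i → sumTo n (λ j → f i * f′ j * pow h (i N.+ j) n))

comp-⊗-expansion : ∀ f f′ h → VanishesBelow 1 h → ∀ n → comp (f ⊗ f′) h n ≡ ProductExpansion f f′ h n
comp-⊗-expansion f f′ h vh n = begin
  sumTo n (λ k → sumTo k (λ i → f i * f′ (k ∸ i)) * pow h k n)
    ≡⟨ sumTo-cong n (λ k _ → sumTo-*ʳ k (pow h k n) _) ⟩
  sumTo n (λ k → sumTo k (λ i → f i * f′ (k ∸ i) * pow h k n))
    ≡⟨ sumTo-triangle n _ ⟩
  sumTo n (λ i → sumTo (n ∸ i) (λ j → f i * f′ (i N.+ j ∸ i) * pow h (i N.+ j) n))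
    ≡⟨ sumTo-cong n (λ i _ → sumTo-cong (n ∸ i) (λ j _ → cong (λ x → f i * f′ x * pow h (i N.+ j) n) (NP.m+n∸m≡n i j))) ⟩
  sumTo n (λ i → sumTo (n ∸ i) (λ j → f i * f′ j * pow h (i N.+ j) n))
    ≡⟨ sumTo-cong n (λ i _ → sym (sumTo-extend (n ∸ i) n _ (NP.m∸n≤m n i) (λ j lt _ → highPower i j lt))) ⟩
  ProductExpansion f f′ h n ∎
  where
  open ≡-Reasoning
  highPower : ∀ i j → n ∸ i < j → f i * f′ j * pow h (i N.+ j) n ≡ 0ℤ
  highPower i j lt = *-zeroʳ-≡ (f i * f′ j) (vanishes-pow h vh (i N.+ j) n (n∸i<j⇒n<i+j n i j lt))

⊗-comp-expansion : ∀ f f′ h → VanishesBelow 1 h → ∀ n → (comp f h ⊗ comp f′ h) n ≡ ProductExpansion f f′ h n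
⊗-comp-expansion f f′ h vh n = begin
  sumTo n (λ a → comp f h a * comp f′ h (n ∸ a))
    ≡⟨ sumTo-cong n (λ a le → cong₂ _*_ (widen f a le) (widen f′ (n ∸ a) (NP.m∸n≤m n a))) ⟩
  sumTo n (λ a → sumTo n (λ i → f i * P i a) * sumTo n (λ j → f′ j * P j (n ∸ a)))
    ≡⟨ sumTo-cong n (λ a _ → trans (sumTo-*ʳ n _ _) (sumTo-cong n (λ i _ → sumTo-*ˡ n (f i * P i a) _))) ⟩
  sumTo n (λ a → sumTo n (λ i → sumTo n (λ j → (f i * P i a) * (f′ j * P j (n ∸ a)))))
    ≡⟨ sumTo-swap n n _ ⟩
  sumTo n (λ i → sumTo n (λ a → sumTo n (λ j → (f i * P i a) * (f′ j * P j (n ∸ a)))))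
    ≡⟨ sumTo-cong n (λ i _ → sumTo-swap n n _) ⟩
  sumTo n (λ i → sumTo n (λ j → sumTo n (λ a → (f i * P i a) * (f′ j * P j (n ∸ a)))))
    ≡⟨ sumTo-cong n (λ i _ → sumTo-cong n (λ j _ → collect i j)) ⟩
  ProductExpansion f f′ h n ∎
  where
  open ≡-Reasoning
  P = pow h
  widen : ∀ g a → a ≤ n → comp g h a ≡ sumTo n (λ i → g i * P i a)
  widen g a le = sym (sumTo-extend a n _ le (λ i lt _ → *-zeroʳ-≡ (g i) (vanishes-pow h vh i a lt)))
  collect : ∀ i j → sumTo n (λ a → (f i * P i a) * (f′ j * P j (n ∸ a))) ≡ f i * f′ j * P (i N.+ j) n
  collect i j = begin
    sumTo n (λ a → (f i * P i a) * (f′ j * P j (n ∸ a)))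
      ≡⟨ sumTo-cong n (λ a _ → *-interchange (f i) (P i a) (f′ j) (P j (n ∸ a))) ⟩
    sumTo n (λ a → (f i * f′ j) * (P i a * P j (n ∸ a)))
      ≡⟨ sym (sumTo-*ˡ n (f i * f′ j) _) ⟩
    f i * f′ j * (P i ⊗ P j) n
      ≡⟨ cong (f i * f′ j *_) (sym (pow-+ h i j n)) ⟩
    f i * f′ j * P (i N.+ j) n ∎

comp-⊗ : ∀ f f′ h → VanishesBelow 1 h → comp (f ⊗ f′) h ≈ comp f h ⊗ comp f′ h
comp-⊗ f f′ h vh n = trans (comp-⊗-expansion f f′ h vh n) (sym (⊗-comp-expansion f f′ h vh n))

comp-pow : ∀ g h → VanishesBelow 1 h → ∀ k → comp (pow g k) h ≈ pow (comp g h) k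
comp-pow g h vh zero    = comp-oneS h
comp-pow g h vh (suc k) = ≈-trans (comp-⊗ g (pow g k) h vh) (⊗-congˡ (comp g h) (comp-pow g h vh k))

comp-assoc : ∀ f g h → VanishesBelow 1 g → VanishesBelow 1 h → comp (comp f g) h ≈ comp f (comp g h)
comp-assoc f g h vg vh n = begin
  sumTo n (λ k → sumTo k (λ l → f l * pow g l k) * pow h k n)
    ≡⟨ sumTo-cong n (λ k _ → sumTo-*ʳ k _ _) ⟩
  sumTo n (λ k → sumTo k (λ l → f l * pow g l k * pow h k n))
    ≡⟨ sumTo-cong n (λ k le → sym (sumTo-extend k n _ le (λ l lt _ → lowCoefficient l k lt))) ⟩
  sumTo n (λ k → sumTo n (λ l → f l * pow g l k * pow h k n))
    ≡⟨ sumTo-swap n n _ ⟩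
  sumTo n (λ l → sumTo n (λ k → f l * pow g l k * pow h k n))
    ≡⟨ sumTo-cong n (λ l _ → trans (sumTo-cong n (λ k _ → ZP.*-assoc (f l) _ _)) (sym (sumTo-*ˡ n (f l) _))) ⟩
  sumTo n (λ l → f l * comp (pow g l) h n)
    ≡⟨ sumTo-cong n (λ l _ → cong (f l *_) (comp-pow g h vh l n)) ⟩
  sumTo n (λ l → f l * pow (comp g h) l n) ∎
  where
  open ≡-Reasoning
  lowCoefficient : ∀ l k → k < l → f l * pow g l k * pow h k n ≡ 0ℤ
  lowCoefficient l k lt = *-zeroˡ-≡ (pow h k n) (*-zeroʳ-≡ (f l) (vanishes-pow g vg l k lt))

⊗-comp-local : ∀ g h F G n → VanishesBelow 1 g → (∀ i → i < n → F i ≡ G i) →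
  (g ⊗ comp F h) n ≡ (g ⊗ comp G h) n
⊗-comp-local g h F G n vg agree = sumTo-cong n term
  where
  term : ∀ i → i ≤ n → g i * comp F h (n ∸ i) ≡ g i * comp G h (n ∸ i)
  term zero    _  = trans (*-zeroˡ-≡ _ (vg 0 (s≤s z≤n))) (sym (*-zeroˡ-≡ _ (vg 0 (s≤s z≤n))))
  term (suc i) le = cong (g (suc i) *_) (sumTo-cong (n ∸ suc i)
    (λ j j≤ → cong (_* pow h j (n ∸ suc i)) (agree j (NP.≤-<-trans j≤ (NP.∸-monoʳ-< (s≤s z≤n) le)))))

-- For g of order ≥ 1 the equation T = 1 + g · (T∘h) has at most one solution,
-- since it determines each coefficient of T from the lower ones.

-- SolvesFE m is this predicate for g = A and h = B.
SolvesEquation : FPS → FPS → FPS → Set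
SolvesEquation g h T = ∀ n → T n ≡ (oneS ⊕ (g ⊗ comp T h)) n

solution-unique : ∀ g h T T′ → VanishesBelow 1 g →
  SolvesEquation g h T → SolvesEquation g h T′ → T ≈ T′
solution-unique g h T T′ vg sT sT′ i = agreeBelow (suc i) i NP.≤-refl
  where
  agreeBelow : ∀ n i → i < n → T i ≡ T′ i
  agreeBelow (suc n) i lt with NP.m≤n⇒m<n∨m≡n (NP.m<1+n⇒m≤n lt)
  ... | inj₁ i<n  = agreeBelow n i i<n
  ... | inj₂ refl = trans (sT i) (trans (cong (oneS i +_) (⊗-comp-local g h T T′ i vg (agreeBelow i))) (sym (sT′ i)))

Aop-cong : ∀ {g g′} → g ≈ g′ → Aop g ≈ Aop g′
Aop-cong p = ⊗-cong p (comp-congˡ geomAlt p)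

Aop-comp : ∀ g h → VanishesBelow 1 g → VanishesBelow 1 h → comp (Aop g) h ≈ Aop (comp g h)
Aop-comp g h vg vh = ≈-trans (comp-⊗ g (comp geomAlt g) h vh) (⊗-congˡ (comp g h) (comp-assoc geomAlt g h vg vh))

vanishes1-Aop : ∀ g → VanishesBelow 1 g → VanishesBelow 1 (Aop g)
vanishes1-Aop g = vanishes1-⊗ g (comp geomAlt g)

vanishes1-Aser : VanishesBelow 1 Aser
vanishes1-Aser = vanishes1-Aop X vanishes1-X

-- Iterates of B for fixed m with m - 2 ≥ 1, which makes g^{m-2} a series of order ≥ 1
-- whenever g is, so that 1/(1+g^{m-2}) is a valid composition.
module Iterates (m : ℕ) (1≤m∸2 : 1 ≤ m ∸ 2) where

  B : FPS
  B = Bser m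

  Bop-cong : ∀ {g g′} → g ≈ g′ → Bop m g ≈ Bop m g′
  Bop-cong p = ⊗-cong p (comp-congˡ geomAlt (pow-cong (m ∸ 2) p))

  Bop-comp : ∀ g h → VanishesBelow 1 g → VanishesBelow 1 h → comp (Bop m g) h ≈ Bop m (comp g h)
  Bop-comp g h vg vh =
    ≈-trans (comp-⊗ g (comp geomAlt (pow g (m ∸ 2))) h vh)
      (⊗-congˡ (comp g h)
        (≈-trans (comp-assoc geomAlt (pow g (m ∸ 2)) h (vanishes1-pow g (m ∸ 2) 1≤m∸2 vg) vh)
                 (comp-congˡ geomAlt (comp-pow g h vh (m ∸ 2)))))

  vanishes1-Bj : ∀ j → VanishesBelow 1 (Bj m j)
  vanishes1-Bj zero    = vanishes1-X
  vanishes1-Bj (suc j) = vanishes1-⊗ (Bj m j) (comp geomAlt (pow (Bj m j) (m ∸ 2))) (vanishes1-Bj j)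

  vanishes1-B : VanishesBelow 1 B
  vanishes1-B = vanishes1-Bj 1

  Bj-comp-B : ∀ j → comp (Bj m j) B ≈ Bj m (suc j)
  Bj-comp-B zero    = comp-X B vanishes1-B
  Bj-comp-B (suc j) = ≈-trans (Bop-comp (Bj m j) B (vanishes1-Bj j) vanishes1-B) (Bop-cong (Bj-comp-B j))

  Aj-comp-B : ∀ j → comp (Aj m j) B ≈ Aj m (suc j)
  Aj-comp-B j = ≈-trans (Aop-comp (Bj m j) B (vanishes1-Bj j) vanishes1-B) (Aop-cong (Bj-comp-B j))

  prodA-shift : ∀ M → Aser ⊗ comp (prodA m M) B ≈ prodA m (suc M)
  prodA-shift zero    = ⊗-congˡ Aser (Aj-comp-B 0)
  prodA-shift (suc M) =
    ≈-trans (⊗-congˡ Aser (comp-⊗ (prodA m M) (Aj m (suc M)) B vanishes1-B))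
      (≈-trans (≈-sym (⊗-assoc Aser (comp (prodA m M) B) (comp (Aj m (suc M)) B)))
               (⊗-cong (prodA-shift M) (Aj-comp-B (suc M))))

  partialSum-step : ∀ M → partialSum m (suc M) ≈ (oneS ⊕ (Aser ⊗ comp (partialSum m M) B))
  partialSum-step zero n =
    cong (oneS n +_) (sym (trans (⊗-congˡ Aser (comp-oneS B) n) (⊗-identityʳ Aser n)))
  partialSum-step (suc M) n = begin
    partialSum m (suc M) n + prodA m (suc M) n
      ≡⟨ cong₂ _+_ (partialSum-step M n) (sym (prodA-shift M n)) ⟩
    (oneS n + (Aser ⊗ comp (partialSum m M) B) n) + (Aser ⊗ comp (prodA m M) B) n
      ≡⟨ ZP.+-assoc (oneS n) _ _ ⟩
    oneS n + ((Aser ⊗ comp (partialSum m M) B) n + (Aser ⊗ comp (prodA m M) B) n)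
      ≡⟨ cong (oneS n +_) (sym (distribute n)) ⟩
    oneS n + (Aser ⊗ comp (partialSum m (suc M)) B) n ∎
    where
    open ≡-Reasoning
    distribute : Aser ⊗ comp (partialSum m (suc M)) B ≈ (Aser ⊗ comp (partialSum m M) B) ⊕ (Aser ⊗ comp (prodA m M) B)
    distribute = ≈-trans (⊗-congˡ Aser (comp-distribʳ-⊕ (partialSum m M) (prodA m M) B))
                         (⊗-distribˡ-⊕ Aser (comp (partialSum m M) B) (comp (prodA m M) B))

  -- P_M is a product of M+1 series of order ≥ 1.
  vanishes-prodA : ∀ M → VanishesBelow (suc M) (prodA m M)
  vanishes-prodA zero    = vanishes1-Aser
  vanishes-prodA (suc M) = subst (λ k → VanishesBelow k (prodA m (suc M))) (NP.+-comm (suc M) 1)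
    (vanishes-⊗ (suc M) 1 (prodA m M) (Aj m (suc M)) (vanishes-prodA M)
                (vanishes1-Aop (Bj m (suc M)) (vanishes1-Bj (suc M))))

  partialSum-stable : ∀ N M → suc N ≤ M → partialSum m M N ≡ partialSum m (suc N) N
  partialSum-stable N (suc M) (s≤s le) with NP.m≤n⇒m<n∨m≡n le
  ... | inj₂ refl = refl
  ... | inj₁ lt   = trans (cong₂ _+_ (partialSum-stable N M lt) (vanishes-prodA M N (s≤s le))) (ZP.+-identityʳ _)

  T∞ : FPS
  T∞ N = partialSum m (suc N) N

  partialSum-converges : ConvergesTo (partialSum m) T∞
  partialSum-converges N = suc N , partialSum-stable N

  T∞-solves : SolvesEquation Aser B T∞
  T∞-solves n = trans (partialSum-step n n)
    (cong (oneS n +_) (⊗-comp-local Aser B (partialSum m n) T∞ n vanishes1-Aser (λ i i<n → partialSum-stable i n i<n)))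

converges-resp-≈ : ∀ {s T T′} → ConvergesTo s T → T ≈ T′ → ConvergesTo s T′
converges-resp-≈ conv eq N = proj₁ (conv N) , λ M le → trans (proj₂ (conv N) M le) (eq N)

theorem2p9 : ∀ (m : ℕ) → 4 ≤ m →
    (Σ FPS λ T → SolvesFE m T × ConvergesTo (partialSum m) T)
    × (∀ (T : FPS) → SolvesFE m T → ConvergesTo (partialSum m) T)
theorem2p9 m 4≤m =
  (T∞ , T∞-solves , partialSum-converges) ,
  λ T sT → converges-resp-≈ partialSum-converges (solution-unique Aser B T∞ T vanishes1-Aser T∞-solves sT)
  where open Iterates m (NP.≤-trans (s≤s z≤n) (NP.∸-monoˡ-≤ 2 4≤m))
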